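{- Let $G$ be a graph that is a path $P_n$ (on $n$ vertices) not isomorphic to $K_2$, or a cycle $C_n$ with $n\ge 3$, or a wheel $W_n$ with $n\ge 4$. Then ${\rm lir}(^2G)\le 2$.
   Context: For a graph $G$, $^2G$ denotes the multigraph (2-multigraph) obtained from $G$ by replacing every edge by two parallel edges. The degree of a vertex in a multigraph counts parallel edges with multiplicity. A multigraph is locally irregular if any two adjacent vertices have distinct degrees. A locally irregular edge coloring of a multigraph $M$ is an assignment of colors to the individual edges of $M$ (the two parallel copies of an edge may receive different colors) such that, for each color, the submultigraph formed by the edges of that color is locally irregular. ${\rm lir}(M)$ is the smallest number of colors in a locally irregular edge coloring of $M$. The wheel $W_n$ is the graph of order $n$ consisting of a cycle of length $n-1$ together with a central vertex adjacent to all vertices of the cycle. -}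

module Defs where

open import Data.Nat using (ℕ; zero; suc; _∸_; _+_)
open import Data.Nat.Properties using (_≟_)
open import Data.Fin using (Fin)
open import Data.Fin.Properties renaming (_≟_ to _≟ᶠ_)
open import Data.List using (List; []; _∷_; map; upTo; length; lookup; _++_; allFin)
open import Data.Nat.ListAction using (sum)
open import Data.Product using (_×_; _,_; proj₁; proj₂)
open import Data.Bool using (Bool; true; false; _∨_; _∧_)
open import Relation.Nullary.Decidable using (⌊_⌋)
open import Relation.Binary.PropositionalEquality using (_≡_; _≢_)

-- A (simple) graph on vertex set {0, …, n-1} given by its list of edges;
-- an edge is an unordered pair written as an ordered pair (u , v).
EdgeList : Set
EdgeList = List (ℕ × ℕ)

pathEdges : ℕ → EdgeList
pathEdges n = map (λ i → (i , suc i)) (upTo (n ∸ 1))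

cycleEdges : ℕ → EdgeList
cycleEdges n = map (λ i → (i , suc i)) (upTo (n ∸ 1)) ++ ((n ∸ 1 , 0) ∷ [])

-- Wheel W_n (n ≥ 4) : centre 0, rim cycle 1, 2, …, n-1, spokes {0, i}.
wheelEdges : ℕ → EdgeList
wheelEdges n =
  map (λ i → (suc i , suc (suc i))) (upTo (n ∸ 2))
  ++ ((n ∸ 1 , 1) ∷ [])
  ++ map (λ i → (0 , suc i)) (upTo (n ∸ 1))

-- An edge colouring of the 2-multigraph ²G with k colours: each edge e of G
-- has two parallel copies (indexed by Fin 2), each copy gets its own colour.
Colouring2 : EdgeList → ℕ → Set
Colouring2 E k = Fin (length E) → Fin 2 → Fin k

incident : ℕ → ℕ × ℕ → Bool
incident v (x , y) = ⌊ v ≟ x ⌋ ∨ ⌊ v ≟ y ⌋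

count : Bool → ℕ
count true = 1
count false = 0

colDeg : (E : EdgeList) {k : ℕ} → Colouring2 E k → Fin k → ℕ → ℕ
colDeg E c a v =
  sum (map (λ e → sum (map (λ j → count (⌊ c e j ≟ᶠ a ⌋ ∧ incident v (lookup E e)))
                           (allFin 2)))
           (allFin (length E)))

LocallyIrregular : (E : EdgeList) {k : ℕ} → Colouring2 E k → Set
LocallyIrregular E c =
  ∀ e j → colDeg E c (c e j) (proj₁ (lookup E e)) ≢ colDeg E c (c e j) (proj₂ (lookup E e))

LirDoubleLE : EdgeList → ℕ → Set
LirDoubleLE E k = Data.Product.Σ (Colouring2 E k) (LocallyIrregular E)

-- Colour both copies of an edge by one of three splits (both 0, one of each, both 1),
-- chosen by the first endpoint of the edge. In each colour an edge then adds the same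
-- weight to both its ends, so the ends of an edge have equal degree exactly when the
-- remaining edges at them carry equal weight. On a path or a cycle these are the edges
-- two steps apart, so it suffices that splits two apart differ: monochrome edges in
-- blocks 0 0 1 1 0 0 …, followed by two mixed edges. On a wheel the rim is split like a
-- cycle and every spoke gets colour 0 twice; the centre then has colour-0 degree at
-- least 8 and every rim vertex at most 6. C₃ and W₄ are checked by computation.

module Submission where

open import Defs
open import Data.Nat using (ℕ; zero; suc; _+_; _*_; _≤_; _<_; z≤n; s≤s; _≡ᵇ_)
open import Data.Nat.Properties
  using ( _≟_; _<?_; +-identityʳ; +-assoc; +-comm; +-cancelˡ-≡; +-cancelʳ-≡; *-identityʳ; *-zeroʳ
        ; ≤-refl; ≤-reflexive; ≤-trans; <⇒≤; <⇒≢; <⇒≱; <-≤-connex; n≤1+n; m≤n⇒m≤1+n; m≤m+n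
        ; m≤n⇒m<n∨m≡n; +-mono-≤; +-monoˡ-≤; *-monoˡ-≤; module ≤-Reasoning )
open import Data.Fin using (Fin; zero; suc)
open import Data.Fin.Properties using (all?) renaming (_≟_ to _≟ᶠ_)
open import Data.Bool using (Bool; true; false; _∨_; _∧_; not; if_then_else_)
open import Data.Bool.Properties using (not-¬)
open import Data.List using (List; []; _∷_; map; upTo; applyUpTo; length; lookup; _++_; allFin)
open import Data.List.Properties
  using (map-∘; map-cong; map-++; map-upTo; map-applyUpTo; map-tabulate; tabulate-lookup; ++-assoc)
open import Data.List.Membership.Propositional using (_∈_)
open import Data.List.Membership.Propositional.Properties using (∈-lookup; ∈-map⁻; ∈-upTo⁻; ∈-++⁻)
open import Data.List.Relation.Unary.Any using (here)
open import Data.Nat.ListAction using (sum)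
open import Data.Nat.ListAction.Properties using (sum-++)
open import Data.Product using (∃; _×_; _,_; proj₁; proj₂)
open import Data.Sum using (_⊎_; inj₁; inj₂)
open import Data.Empty using (⊥; ⊥-elim)
open import Function using (_∘_; id)
open import Relation.Nullary using (Dec; yes; no)
open import Relation.Nullary.Decidable using (⌊_⌋; isYes≗does; dec-true; dec-false; from-yes; ¬?)
open import Relation.Binary.PropositionalEquality
  using (_≡_; _≢_; refl; sym; trans; cong; cong₂; subst; module ≡-Reasoning)

data Split : Set where
  zeros mixed ones : Split

paint : Split → Fin 2 → Fin 2
paint zeros _ = zero
paint mixed j = j
paint ones  _ = suc zero

copies : Fin 2 → Split → ℕ
copies zero       zeros = 2
copies zero       mixed = 1
copies zero       ones  = 0
copies (suc zero) zeros = 0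
copies (suc zero) mixed = 1
copies (suc zero) ones  = 2

fromCopies : Fin 2 → ℕ → Split
fromCopies zero       0 = ones
fromCopies zero       1 = mixed
fromCopies zero       _ = zeros
fromCopies (suc zero) 0 = zeros
fromCopies (suc zero) 1 = mixed
fromCopies (suc zero) _ = ones

fromCopies-copies : ∀ a s → fromCopies a (copies a s) ≡ s
fromCopies-copies zero       zeros = refl
fromCopies-copies zero       mixed = refl
fromCopies-copies zero       ones  = refl
fromCopies-copies (suc zero) zeros = refl
fromCopies-copies (suc zero) mixed = refl
fromCopies-copies (suc zero) ones  = refl

copies-injective : ∀ a {s t} → copies a s ≡ copies a t → s ≡ t
copies-injective a {s} {t} eq =
  trans (sym (fromCopies-copies a s)) (trans (cong (fromCopies a) eq) (fromCopies-copies a t))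

copies-≢ : ∀ a {s t} → s ≢ t → copies a s ≢ copies a t
copies-≢ a s≢t eq = s≢t (copies-injective a eq)

copies-≤ : ∀ a s → copies a s ≤ 2
copies-≤ zero       zeros = ≤-refl
copies-≤ zero       mixed = s≤s z≤n
copies-≤ zero       ones  = z≤n
copies-≤ (suc zero) zeros = z≤n
copies-≤ (suc zero) mixed = s≤s z≤n
copies-≤ (suc zero) ones  = ≤-refl

copies-mixed≢0 : ∀ a → copies a mixed ≢ 0
copies-mixed≢0 zero       ()
copies-mixed≢0 (suc zero) ()

colourBy : (E : EdgeList) → (ℕ → Split) → Colouring2 E 2
colourBy E σ e = paint (σ (proj₁ (lookup E e)))

-- `incident` goes through `isYes`, which is stuck on open terms; `_≡ᵇ_` computes.
touches : ℕ → ℕ × ℕ → Bool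
touches v (x , y) = (v ≡ᵇ x) ∨ (v ≡ᵇ y)

incident≡touches : ∀ v e → incident v e ≡ touches v e
incident≡touches v (x , y) = cong₂ _∨_ (isYes≗does (v ≟ x)) (isYes≗does (v ≟ y))

wdeg : (ℕ → ℕ) → EdgeList → ℕ → ℕ
wdeg K E v = sum (map (λ e → if touches v e then K (proj₁ e) else 0) E)

paint-count : ∀ s a b →
  sum (map (λ j → count (⌊ paint s j ≟ᶠ a ⌋ ∧ b)) (allFin 2)) ≡ copies a s * count b
paint-count zeros zero       b = refl
paint-count zeros (suc zero) b = refl
paint-count mixed zero       b = refl
paint-count mixed (suc zero) b = refl
paint-count ones  zero       b = refl
paint-count ones  (suc zero) b = refl

*-count : ∀ k b → k * count b ≡ (if b then k else 0)
*-count k true  = *-identityʳ k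
*-count k false = *-zeroʳ k

map-lookup-allFin : ∀ {A : Set} (xs : List A) → map (lookup xs) (allFin (length xs)) ≡ xs
map-lookup-allFin xs = trans (map-tabulate id (lookup xs)) (tabulate-lookup xs)

colDeg-colourBy : ∀ E σ a v → colDeg E (colourBy E σ) a v ≡ wdeg (copies a ∘ σ) E v
colDeg-colourBy E σ a v = begin
  sum (map (share ∘ lookup E) (allFin (length E)))  ≡⟨ cong sum (map-∘ (allFin (length E))) ⟩
  sum (map share (map (lookup E) (allFin (length E)))) ≡⟨ cong (sum ∘ map share) (map-lookup-allFin E) ⟩
  sum (map share E)                                  ≡⟨ cong sum (map-cong share≡weight E) ⟩
  wdeg (copies a ∘ σ) E v                            ∎
  where
  open ≡-Reasoning
  share : ℕ × ℕ → ℕ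
  share e = sum (map (λ j → count (⌊ paint (σ (proj₁ e)) j ≟ᶠ a ⌋ ∧ incident v e)) (allFin 2))
  share≡weight : ∀ e → share e ≡ (if touches v e then copies a (σ (proj₁ e)) else 0)
  share≡weight e = begin
    share e                                            ≡⟨ paint-count (σ (proj₁ e)) a (incident v e) ⟩
    copies a (σ (proj₁ e)) * count (incident v e)      ≡⟨ cong (λ b → copies a (σ (proj₁ e)) * count b) (incident≡touches v e) ⟩
    copies a (σ (proj₁ e)) * count (touches v e)       ≡⟨ *-count _ (touches v e) ⟩
    (if touches v e then copies a (σ (proj₁ e)) else 0) ∎

-- Only the colours actually present on the edge are constrained.
IrregularEdge : EdgeList → (ℕ → Split) → ℕ × ℕ → Set
IrregularEdge E σ e =
  ∀ j → let K = copies (paint (σ (proj₁ e)) j) ∘ σ in wdeg K E (proj₁ e) ≢ wdeg K E (proj₂ e)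

colourBy-locallyIrregular : ∀ E σ → (∀ {e} → e ∈ E → IrregularEdge E σ e) →
  LocallyIrregular E (colourBy E σ)
colourBy-locallyIrregular E σ irr e j eq =
  irr (∈-lookup {xs = E} e) j (trans (sym (colDeg-colourBy E σ a x)) (trans eq (colDeg-colourBy E σ a y)))
  where
  x = proj₁ (lookup E e)
  y = proj₂ (lookup E e)
  a = paint (σ x) j

locallyIrregular? : ∀ E {k} (c : Colouring2 E k) → Dec (LocallyIrregular E c)
locallyIrregular? E c = all? λ e → all? λ j →
  ¬? (colDeg E c (c e j) (proj₁ (lookup E e)) ≟ colDeg E c (c e j) (proj₂ (lookup E e)))

wdeg-++ : ∀ K E F v → wdeg K (E ++ F) v ≡ wdeg K E v + wdeg K F v
wdeg-++ K E F v = trans (cong sum (map-++ _ E F)) (sum-++ (map _ E) _)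

shift : ℕ × ℕ → ℕ × ℕ
shift (x , y) = (suc x , suc y)

wdeg-shift-suc : ∀ K E v → wdeg K (map shift E) (suc v) ≡ wdeg (K ∘ suc) E v
wdeg-shift-suc K []            v = refl
wdeg-shift-suc K ((x , y) ∷ E) v = cong (_ +_) (wdeg-shift-suc K E v)

wdeg-shift-zero : ∀ K E → wdeg K (map shift E) 0 ≡ 0
wdeg-shift-zero K []            = refl
wdeg-shift-zero K ((x , y) ∷ E) = wdeg-shift-zero K E

-- The path 0 — 1 — ⋯ — m, so that pathEdges (suc m) = path m.
path : ℕ → EdgeList
path m = map (λ i → (i , suc i)) (upTo m)

path-suc : ∀ m → path (suc m) ≡ (0 , 1) ∷ map shift (path m)
path-suc m = cong ((0 , 1) ∷_) (begin
  map (λ i → (i , suc i)) (applyUpTo suc m)  ≡⟨ map-applyUpTo suc _ m ⟩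
  applyUpTo (λ i → (suc i , suc (suc i))) m  ≡⟨ sym (map-upTo _ m) ⟩
  map (shift ∘ λ i → (i , suc i)) (upTo m)   ≡⟨ map-∘ (upTo m) ⟩
  map shift (path m)                         ∎)
  where open ≡-Reasoning

∈-path⁻ : ∀ {m e} → e ∈ path m → ∃ λ i → i < m × e ≡ (i , suc i)
∈-path⁻ {m} e∈ with ∈-map⁻ (λ i → (i , suc i)) e∈
... | i , i∈ , e≡ = i , ∈-upTo⁻ i∈ , e≡

restrict : ℕ → (ℕ → ℕ) → ℕ → ℕ
restrict zero    K i       = 0
restrict (suc m) K zero    = K 0
restrict (suc m) K (suc i) = restrict m (K ∘ suc) i

restrict-< : ∀ {m} K {i} → i < m → restrict m K i ≡ K i
restrict-< {suc m} K {zero}  _         = refl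
restrict-< {suc m} K {suc i} (s≤s i<m) = restrict-< (K ∘ suc) i<m

restrict-≥ : ∀ {m} K {i} → m ≤ i → restrict m K i ≡ 0
restrict-≥ {zero}  K {i}     _         = refl
restrict-≥ {suc m} K {suc i} (s≤s m≤i) = restrict-≥ (K ∘ suc) m≤i

wdeg-path-zero : ∀ K m → wdeg K (path m) 0 ≡ restrict m K 0
wdeg-path-zero K zero    = refl
wdeg-path-zero K (suc m) = begin
  wdeg K (path (suc m)) 0               ≡⟨ cong (λ E → wdeg K E 0) (path-suc m) ⟩
  K 0 + wdeg K (map shift (path m)) 0   ≡⟨ cong (K 0 +_) (wdeg-shift-zero K (path m)) ⟩
  K 0 + 0                               ≡⟨ +-identityʳ (K 0) ⟩
  K 0                                   ∎
  where open ≡-Reasoning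

wdeg-path-suc : ∀ K m v → wdeg K (path m) (suc v) ≡ restrict m K v + restrict m K (suc v)
wdeg-path-suc K zero    v       = refl
wdeg-path-suc K (suc m) zero    = begin
  wdeg K (path (suc m)) 1               ≡⟨ cong (λ E → wdeg K E 1) (path-suc m) ⟩
  K 0 + wdeg K (map shift (path m)) 1   ≡⟨ cong (K 0 +_) (wdeg-shift-suc K (path m) 0) ⟩
  K 0 + wdeg (K ∘ suc) (path m) 0       ≡⟨ cong (K 0 +_) (wdeg-path-zero (K ∘ suc) m) ⟩
  K 0 + restrict m (K ∘ suc) 0          ∎
  where open ≡-Reasoning
wdeg-path-suc K (suc m) (suc v) = begin
  wdeg K (path (suc m)) (suc (suc v))   ≡⟨ cong (λ E → wdeg K E (suc (suc v))) (path-suc m) ⟩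
  wdeg K (map shift (path m)) (suc (suc v)) ≡⟨ wdeg-shift-suc K (path m) (suc v) ⟩
  wdeg (K ∘ suc) (path m) (suc v)       ≡⟨ wdeg-path-suc (K ∘ suc) m v ⟩
  restrict m (K ∘ suc) v + restrict m (K ∘ suc) (suc v) ∎
  where open ≡-Reasoning

path-first-edge : ∀ K m → wdeg K (path m) 0 ≡ wdeg K (path m) 1 → restrict m K 1 ≡ 0
path-first-edge K m eq = sym (+-cancelˡ-≡ (restrict m K 0) 0 (restrict m K 1) (begin
  restrict m K 0 + 0                ≡⟨ +-identityʳ _ ⟩
  restrict m K 0                    ≡⟨ sym (wdeg-path-zero K m) ⟩
  wdeg K (path m) 0                 ≡⟨ eq ⟩
  wdeg K (path m) 1                 ≡⟨ wdeg-path-suc K m 0 ⟩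
  restrict m K 0 + restrict m K 1   ∎))
  where open ≡-Reasoning

path-inner-edge : ∀ K m k → wdeg K (path m) (suc k) ≡ wdeg K (path m) (suc (suc k)) →
                  restrict m K k ≡ restrict m K (suc (suc k))
path-inner-edge K m k eq = +-cancelˡ-≡ (restrict m K (suc k)) _ _ (begin
  restrict m K (suc k) + restrict m K k           ≡⟨ +-comm _ (restrict m K k) ⟩
  restrict m K k + restrict m K (suc k)           ≡⟨ sym (wdeg-path-suc K m k) ⟩
  wdeg K (path m) (suc k)                         ≡⟨ eq ⟩
  wdeg K (path m) (suc (suc k))                   ≡⟨ wdeg-path-suc K m (suc k) ⟩
  restrict m K (suc k) + restrict m K (suc (suc k)) ∎)
  where open ≡-Reasoning

phase : ℕ → Bool
phase 0             = false
phase 1             = false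
phase (suc (suc i)) = not (phase i)

monochrome : Bool → Split
monochrome false = zeros
monochrome true  = ones

monochrome-injective : ∀ {b c} → monochrome b ≡ monochrome c → b ≡ c
monochrome-injective {false} {false} _ = refl
monochrome-injective {true}  {true}  _ = refl

monochrome≢mixed : ∀ b → monochrome b ≢ mixed
monochrome≢mixed false ()
monochrome≢mixed true  ()

-- Splits two apart always differ; the last two edges are mixed so that the end
-- vertices of a path still see nonzero weight, and so that a cycle closes up.
pathSplit : ℕ → ℕ → Split
pathSplit m i with suc (suc i) <? m
... | yes _ = monochrome (phase i)
... | no  _ = mixed

pathSplit-monochrome : ∀ {m i} → suc (suc i) < m → pathSplit m i ≡ monochrome (phase i)
pathSplit-monochrome {m} {i} i+2<m with suc (suc i) <? m
... | yes _       = refl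
... | no  i+2≮m   = ⊥-elim (i+2≮m i+2<m)

pathSplit-mixed : ∀ {m i} → m ≤ suc (suc i) → pathSplit m i ≡ mixed
pathSplit-mixed {m} {i} m≤i+2 with suc (suc i) <? m
... | yes i+2<m = ⊥-elim (<⇒≱ i+2<m m≤i+2)
... | no  _     = refl

pathSplit-+2 : ∀ {m i} → suc (suc i) < m → pathSplit m i ≢ pathSplit m (suc (suc i))
pathSplit-+2 {m} {i} i+2<m eq with <-≤-connex (suc (suc (suc (suc i)))) m
... | inj₁ i+4<m = not-¬ refl (monochrome-injective (begin
  monochrome (phase i)                   ≡⟨ sym (pathSplit-monochrome i+2<m) ⟩
  pathSplit m i                          ≡⟨ eq ⟩
  pathSplit m (suc (suc i))              ≡⟨ pathSplit-monochrome i+4<m ⟩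
  monochrome (not (phase i))             ∎))
  where open ≡-Reasoning
... | inj₂ m≤i+4 = monochrome≢mixed (phase i)
  (trans (sym (pathSplit-monochrome i+2<m)) (trans eq (pathSplit-mixed m≤i+4)))

pathSplit-second≢0 : ∀ m j → copies (paint (pathSplit m 0) j) (pathSplit m 1) ≢ 0
pathSplit-second≢0 m j with <-≤-connex 3 m
... | inj₁ 3<m rewrite pathSplit-monochrome (<⇒≤ 3<m) | pathSplit-monochrome 3<m = λ ()
... | inj₂ m≤3 rewrite pathSplit-mixed {m} {1} m≤3 = copies-mixed≢0 _

pathSplit-irregular : ∀ p {e} → e ∈ path (2 + p) → IrregularEdge (path (2 + p)) (pathSplit (2 + p)) e
pathSplit-irregular p e∈ with ∈-path⁻ e∈
... | zero , _ , refl = λ j eq →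
  let K = copies (paint (pathSplit m 0) j) ∘ pathSplit m
  in pathSplit-second≢0 m j
       (trans (sym (restrict-< {m} K {1} (s≤s (s≤s z≤n)))) (path-first-edge K m eq))
  where m = 2 + p
... | suc k , k+1<m , refl = λ j → inner-edge (paint (pathSplit m (suc k)) j)
  where
  m = 2 + p
  inner-edge : ∀ a → let K = copies a ∘ pathSplit m in wdeg K (path m) (suc k) ≢ wdeg K (path m) (suc (suc k))
  inner-edge a eq = two-apart (<-≤-connex (suc (suc k)) m)
    where
    K = copies a ∘ pathSplit m
    same : K k ≡ restrict m K (suc (suc k))
    same = trans (sym (restrict-< K (<⇒≤ k+1<m))) (path-inner-edge K m k eq)
    two-apart : suc (suc k) < m ⊎ m ≤ suc (suc k) → ⊥
    two-apart (inj₁ k+2<m) = pathSplit-+2 k+2<m (copies-injective a (trans same (restrict-< K k+2<m)))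
    two-apart (inj₂ m≤k+2) = copies-mixed≢0 a
      (trans (cong (copies a) (sym (pathSplit-mixed m≤k+2))) (trans same (restrict-≥ K m≤k+2)))

-- The cycle 0 — 1 — ⋯ — m — 0, so that cycleEdges (suc m) = cycle m.
cycle : ℕ → EdgeList
cycle m = path m ++ (m , 0) ∷ []

wdeg-closing : ∀ K q w → wdeg K ((suc q , 0) ∷ []) (suc w) ≡ (if w ≡ᵇ q then K (suc q) else 0)
wdeg-closing K q w with w ≡ᵇ q
... | true  = +-identityʳ (K (suc q))
... | false = refl

wdeg-cycle-zero : ∀ K q → wdeg K (cycle (suc q)) 0 ≡ K 0 + K (suc q)
wdeg-cycle-zero K q = begin
  wdeg K (cycle (suc q)) 0                                  ≡⟨ wdeg-++ K (path (suc q)) _ 0 ⟩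
  wdeg K (path (suc q)) 0 + (K (suc q) + 0)                 ≡⟨ cong₂ _+_ (wdeg-path-zero K (suc q)) (+-identityʳ _) ⟩
  K 0 + K (suc q)                                           ∎
  where open ≡-Reasoning

wdeg-cycle-suc : ∀ K q {w} → w ≤ q → wdeg K (cycle (suc q)) (suc w) ≡ K w + K (suc w)
wdeg-cycle-suc K q {w} w≤q = begin
  wdeg K (cycle (suc q)) (suc w)
    ≡⟨ wdeg-++ K (path (suc q)) _ (suc w) ⟩
  wdeg K (path (suc q)) (suc w) + wdeg K ((suc q , 0) ∷ []) (suc w)
    ≡⟨ cong₂ _+_ (wdeg-path-suc K (suc q) w) (wdeg-closing K q w) ⟩
  restrict (suc q) K w + restrict (suc q) K (suc w) + (if w ≡ᵇ q then K (suc q) else 0)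
    ≡⟨ cong (λ r → r + restrict (suc q) K (suc w) + (if w ≡ᵇ q then K (suc q) else 0)) (restrict-< K (s≤s w≤q)) ⟩
  K w + restrict (suc q) K (suc w) + (if w ≡ᵇ q then K (suc q) else 0)
    ≡⟨ +-assoc (K w) _ _ ⟩
  K w + (restrict (suc q) K (suc w) + (if w ≡ᵇ q then K (suc q) else 0))
    ≡⟨ cong (K w +_) (restrict-or-closing (m≤n⇒m<n∨m≡n w≤q)) ⟩
  K w + K (suc w)
    ∎
  where
  open ≡-Reasoning
  restrict-or-closing : w < q ⊎ w ≡ q →
    restrict (suc q) K (suc w) + (if w ≡ᵇ q then K (suc q) else 0) ≡ K (suc w)
  restrict-or-closing (inj₁ w<q) rewrite dec-false (w ≟ q) (<⇒≢ w<q) =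
    trans (+-identityʳ _) (restrict-< K (s≤s w<q))
  restrict-or-closing (inj₂ refl) rewrite dec-true (w ≟ w) refl =
    cong (_+ K (suc w)) (restrict-≥ K (≤-refl {suc w}))

-- Adjacent vertices of a cycle share the weight of their common edge, so their
-- degrees differ exactly when the weights two steps apart around that edge do.
cycle-irregular : ∀ q K → K (suc q) ≢ K 1 → (∀ {k} → k < q → K k ≢ K (suc (suc k))) → K q ≢ K 0 →
  ∀ {x y} → (x , y) ∈ cycle (suc q) → wdeg K (cycle (suc q)) x ≢ wdeg K (cycle (suc q)) y
cycle-irregular q K first inner closing e∈ with ∈-++⁻ (path (suc q)) e∈
... | inj₂ (here refl) = λ eq → closing (+-cancelʳ-≡ (K (suc q)) _ _ (begin
  K q + K (suc q)                   ≡⟨ sym (wdeg-cycle-suc K q ≤-refl) ⟩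
  wdeg K (cycle (suc q)) (suc q)    ≡⟨ eq ⟩
  wdeg K (cycle (suc q)) 0          ≡⟨ wdeg-cycle-zero K q ⟩
  K 0 + K (suc q)                   ∎))
  where open ≡-Reasoning
... | inj₁ p∈ with ∈-path⁻ p∈
...   | zero , _ , refl = λ eq → first (+-cancelˡ-≡ (K 0) _ _ (begin
  K 0 + K (suc q)                   ≡⟨ sym (wdeg-cycle-zero K q) ⟩
  wdeg K (cycle (suc q)) 0          ≡⟨ eq ⟩
  wdeg K (cycle (suc q)) 1          ≡⟨ wdeg-cycle-suc K q z≤n ⟩
  K 0 + K 1                         ∎))
  where open ≡-Reasoning
...   | suc k , s≤s k<q , refl = λ eq → inner k<q (+-cancelˡ-≡ (K (suc k)) _ _ (begin
  K (suc k) + K k                   ≡⟨ +-comm (K (suc k)) (K k) ⟩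
  K k + K (suc k)                   ≡⟨ sym (wdeg-cycle-suc K q (<⇒≤ k<q)) ⟩
  wdeg K (cycle (suc q)) (suc k)    ≡⟨ eq ⟩
  wdeg K (cycle (suc q)) (suc (suc k)) ≡⟨ wdeg-cycle-suc K q k<q ⟩
  K (suc k) + K (suc (suc k))       ∎))
  where open ≡-Reasoning

pathSplit-cycle-irregular : ∀ r a {x y} → (x , y) ∈ cycle (3 + r) →
  wdeg (copies a ∘ pathSplit (4 + r)) (cycle (3 + r)) x ≢ wdeg (copies a ∘ pathSplit (4 + r)) (cycle (3 + r)) y
pathSplit-cycle-irregular r a = cycle-irregular (2 + r) (copies a ∘ τ)
  (copies-≢ a λ eq → monochrome≢mixed false
    (trans (sym (pathSplit-monochrome {4 + r} {1} 3<n)) (trans (sym eq) last)))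
  (λ k<q → copies-≢ a (pathSplit-+2 (s≤s (s≤s k<q))))
  (copies-≢ a λ eq → monochrome≢mixed false
    (trans (sym (pathSplit-monochrome {4 + r} {0} 2<n)) (trans (sym eq) second-last)))
  where
  τ = pathSplit (4 + r)
  3<n : 3 < 4 + r
  3<n = s≤s (s≤s (s≤s (s≤s z≤n)))
  2<n : 2 < 4 + r
  2<n = <⇒≤ 3<n
  last : τ (3 + r) ≡ mixed
  last = pathSplit-mixed {4 + r} {3 + r} (s≤s (s≤s (s≤s (s≤s (n≤1+n r)))))
  second-last : τ (2 + r) ≡ mixed
  second-last = pathSplit-mixed {4 + r} {2 + r} ≤-refl

spokes : ℕ → EdgeList
spokes R = map (λ i → (0 , suc i)) (upTo R)

-- The wheel with centre 0 and rim cycle 1 — 2 — ⋯ — (2 + q) — 1.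
wheel : ℕ → EdgeList
wheel q = map shift (cycle (suc q)) ++ spokes (2 + q)

wheelEdges≡wheel : ∀ q → wheelEdges (3 + q) ≡ wheel q
wheelEdges≡wheel q = begin
  map (shift ∘ λ i → (i , suc i)) (upTo (suc q)) ++ (rimClosing ∷ []) ++ spokes (2 + q)
    ≡⟨ sym (++-assoc (map (shift ∘ λ i → (i , suc i)) (upTo (suc q))) _ _) ⟩
  (map (shift ∘ λ i → (i , suc i)) (upTo (suc q)) ++ rimClosing ∷ []) ++ spokes (2 + q)
    ≡⟨ cong (λ rim → (rim ++ rimClosing ∷ []) ++ spokes (2 + q)) (map-∘ (upTo (suc q))) ⟩
  (map shift (path (suc q)) ++ map shift ((suc q , 0) ∷ [])) ++ spokes (2 + q)
    ≡⟨ cong (_++ spokes (2 + q)) (sym (map-++ shift (path (suc q)) _)) ⟩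
  wheel q
    ∎
  where
  open ≡-Reasoning
  rimClosing = (2 + q , 1)

sum-applyUpTo-const : ∀ c R → sum (applyUpTo (λ _ → c) R) ≡ R * c
sum-applyUpTo-const c zero    = refl
sum-applyUpTo-const c (suc R) = cong (c +_) (sum-applyUpTo-const c R)

sum-applyUpTo-indicator : ∀ c {w R} → w < R → sum (applyUpTo (λ i → if w ≡ᵇ i then c else 0) R) ≡ c
sum-applyUpTo-indicator c {zero}  {suc R} _ =
  trans (cong (c +_) (trans (sum-applyUpTo-const 0 R) (*-zeroʳ R))) (+-identityʳ c)
sum-applyUpTo-indicator c {suc w} {suc R} (s≤s w<R) = sum-applyUpTo-indicator c w<R

wdeg-spokes : ∀ K R v →
  wdeg K (spokes R) v ≡ sum (applyUpTo (λ i → if touches v (0 , suc i) then K 0 else 0) R)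
wdeg-spokes K R v = cong sum (trans (sym (map-∘ (upTo R))) (map-upTo _ R))

wdeg-wheel-centre : ∀ K q → wdeg K (wheel q) 0 ≡ (2 + q) * K 0
wdeg-wheel-centre K q = begin
  wdeg K (wheel q) 0
    ≡⟨ wdeg-++ K (map shift (cycle (suc q))) _ 0 ⟩
  wdeg K (map shift (cycle (suc q))) 0 + wdeg K (spokes (2 + q)) 0
    ≡⟨ cong₂ _+_ (wdeg-shift-zero K (cycle (suc q))) (wdeg-spokes K (2 + q) 0) ⟩
  sum (applyUpTo (λ _ → K 0) (2 + q))
    ≡⟨ sum-applyUpTo-const (K 0) (2 + q) ⟩
  (2 + q) * K 0
    ∎
  where open ≡-Reasoning

wdeg-wheel-rim : ∀ K q {v} → v < 2 + q → wdeg K (wheel q) (suc v) ≡ wdeg (K ∘ suc) (cycle (suc q)) v + K 0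
wdeg-wheel-rim K q {v} v<n = begin
  wdeg K (wheel q) (suc v)
    ≡⟨ wdeg-++ K (map shift (cycle (suc q))) _ (suc v) ⟩
  wdeg K (map shift (cycle (suc q))) (suc v) + wdeg K (spokes (2 + q)) (suc v)
    ≡⟨ cong₂ _+_ (wdeg-shift-suc K (cycle (suc q)) v) (wdeg-spokes K (2 + q) (suc v)) ⟩
  wdeg (K ∘ suc) (cycle (suc q)) v + sum (applyUpTo (λ i → if v ≡ᵇ i then K 0 else 0) (2 + q))
    ≡⟨ cong (wdeg (K ∘ suc) (cycle (suc q)) v +_) (sum-applyUpTo-indicator (K 0) v<n) ⟩
  wdeg (K ∘ suc) (cycle (suc q)) v + K 0
    ∎
  where open ≡-Reasoning

∈-cycle-< : ∀ {q x y} → (x , y) ∈ cycle (suc q) → x < 2 + q × y < 2 + q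
∈-cycle-< {q} e∈ with ∈-++⁻ (path (suc q)) e∈
... | inj₂ (here refl) = ≤-refl , s≤s z≤n
... | inj₁ p∈ with ∈-path⁻ p∈
...   | i , i<m , refl = m≤n⇒m≤1+n i<m , s≤s i<m

wdeg-cycle-≤ : ∀ K q {c} → (∀ i → K i ≤ c) → ∀ {v} → v < 2 + q → wdeg K (cycle (suc q)) v ≤ c + c
wdeg-cycle-≤ K q K≤c {zero}  _ =
  ≤-trans (≤-reflexive (wdeg-cycle-zero K q)) (+-mono-≤ (K≤c 0) (K≤c (suc q)))
wdeg-cycle-≤ K q K≤c {suc w} (s≤s (s≤s w≤q)) =
  ≤-trans (≤-reflexive (wdeg-cycle-suc K q w≤q)) (+-mono-≤ (K≤c w) (K≤c (suc w)))

wheelSplit : ℕ → ℕ → Split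
wheelSplit R zero    = zeros
wheelSplit R (suc v) = pathSplit R v

spoke-centre-heavier : ∀ r {i} → i < 4 + r →
  let K = copies zero ∘ wheelSplit (4 + r) in wdeg K (wheel (2 + r)) (suc i) < wdeg K (wheel (2 + r)) 0
spoke-centre-heavier r {i} i<R = begin-strict
  wdeg K (wheel (2 + r)) (suc i)
    ≡⟨ wdeg-wheel-rim K (2 + r) i<R ⟩
  wdeg (K ∘ suc) (cycle (3 + r)) i + 2
    ≤⟨ +-monoˡ-≤ 2 (wdeg-cycle-≤ (K ∘ suc) (2 + r) (copies-≤ zero ∘ pathSplit (4 + r)) i<R) ⟩
  6
    <⟨ s≤s (s≤s (s≤s (s≤s (s≤s (s≤s (s≤s z≤n)))))) ⟩
  4 * 2
    ≤⟨ *-monoˡ-≤ 2 (m≤m+n 4 r) ⟩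
  (4 + r) * 2
    ≡⟨ sym (wdeg-wheel-centre K (2 + r)) ⟩
  wdeg K (wheel (2 + r)) 0
    ∎
  where
  open ≤-Reasoning
  K = copies zero ∘ wheelSplit (4 + r)

wheelSplit-irregular : ∀ r {e} → e ∈ wheel (2 + r) → IrregularEdge (wheel (2 + r)) (wheelSplit (4 + r)) e
wheelSplit-irregular r e∈ with ∈-++⁻ (map shift (cycle (3 + r))) e∈
... | inj₂ s∈ with ∈-map⁻ (λ i → (0 , suc i)) s∈
...   | i , i∈ , refl = λ j eq → <⇒≢ (spoke-centre-heavier r (∈-upTo⁻ i∈)) (sym eq)
wheelSplit-irregular r e∈ | inj₁ r∈ with ∈-map⁻ shift r∈
...   | (x , y) , c∈ , refl = λ j eq →
  let a = paint (pathSplit (4 + r) x) j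
      K = copies a ∘ wheelSplit (4 + r)
      x<R , y<R = ∈-cycle-< c∈
  in pathSplit-cycle-irregular r a c∈ (+-cancelʳ-≡ (K 0) _ _
       (trans (sym (wdeg-wheel-rim K (2 + r) x<R)) (trans eq (wdeg-wheel-rim K (2 + r) y<R))))

triangle : LirDoubleLE (cycleEdges 3) 2
triangle = c , from-yes (locallyIrregular? (cycleEdges 3) c)
  where
  c = colourBy (cycleEdges 3) λ { 0 → ones ; 1 → mixed ; _ → zeros }

wheel₄ : LirDoubleLE (wheelEdges 4) 2
wheel₄ = c , from-yes (locallyIrregular? (wheelEdges 4) c)
  where
  c = colourBy (wheelEdges 4) λ { 0 → zeros ; 1 → zeros ; 2 → mixed ; _ → ones }

lir-path : ∀ n → 1 ≤ n → n ≢ 2 → LirDoubleLE (pathEdges n) 2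
lir-path 1                   _ _   = (λ ()) , λ ()
lir-path 2                   _ n≢2 = ⊥-elim (n≢2 refl)
lir-path (suc (suc (suc p))) _ _   =
  colourBy P (pathSplit (2 + p)) , colourBy-locallyIrregular P (pathSplit (2 + p)) (pathSplit-irregular p)
  where P = path (2 + p)

lir-cycle : ∀ n → 3 ≤ n → LirDoubleLE (cycleEdges n) 2
lir-cycle 1                         (s≤s ())
lir-cycle 2                         (s≤s (s≤s ()))
lir-cycle 3                         _ = triangle
lir-cycle (suc (suc (suc (suc r)))) _ =
  colourBy C (pathSplit (4 + r)) ,
  colourBy-locallyIrregular C (pathSplit (4 + r)) λ { {x , y} e∈ j → pathSplit-cycle-irregular r _ e∈ }
  where C = cycle (3 + r)

lir-wheel : ∀ n → 4 ≤ n → LirDoubleLE (wheelEdges n) 2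
lir-wheel 1                               (s≤s ())
lir-wheel 2                               (s≤s (s≤s ()))
lir-wheel 3                               (s≤s (s≤s (s≤s ())))
lir-wheel 4                               _ = wheel₄
lir-wheel (suc (suc (suc (suc (suc r))))) _ =
  subst (λ E → LirDoubleLE E 2) (sym (wheelEdges≡wheel (2 + r)))
    (colourBy W (wheelSplit (4 + r)) , colourBy-locallyIrregular W (wheelSplit (4 + r)) (wheelSplit-irregular r))
  where W = wheel (2 + r)

theorem2 : (∀ n → 1 ≤ n → n ≢ 2 → LirDoubleLE (pathEdges n) 2)
    × (∀ n → 3 ≤ n → LirDoubleLE (cycleEdges n) 2)
    × (∀ n → 4 ≤ n → LirDoubleLE (wheelEdges n) 2)
theorem2 = lir-path , lir-cycle , lir-wheel
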